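{- Let $q$ be a prime power, $t$ a positive integer, and $\mathbb K$ the algebraic closure of $\mathbb F_q$. For $a\in\mathbb K\setminus\{0\}$ and $B=(b_1,\ldots,b_t)\in\mathbb K^t$ let \[ f_{a,B}(x)=a^q x+b_1x^q+\cdots+b_t x^{q^t}+(-1)^{t+1}a\,x^{q^{t+1}}\in\mathbb K[x], \] and let $V=\ker f_{a,B}$ be its set of roots in $\mathbb K$. Then $V=\ker f_{c,D}$ for some $c\in\mathbb K\setminus\{0\}$ and $D\in\mathbb K^t$ if and only if $c=\lambda a$ and $D=\lambda B$ for some $\lambda\in\mathbb F_q$.
   Context: $\ker f$ denotes the set of roots in $\mathbb K$ of the polynomial $f$; for $f_{c,D}$ the definition is the same formula with $a$ replaced by $c$ and $B$ by $D$. -}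

module Defs where

open import Level using (Level; _⊔_)
open import Data.Nat as ℕ using (ℕ; zero; suc)
open import Data.Nat.Primality using (Prime)
open import Data.Vec using (Vec; []; _∷_)
open import Data.Product using (Σ; ∃; _×_; _,_)
open import Relation.Nullary using (¬_)
open import Algebra.Bundles using (CommutativeRing)
import Data.Unit.Polymorphic
import Data.Vec

module _ {c ℓ : Level} (K : CommutativeRing c ℓ) where
  open CommutativeRing K

  pow : Carrier → ℕ → Carrier
  pow x zero    = 1#
  pow x (suc n) = x * pow x n

  natK : ℕ → Carrier
  natK zero    = 0#
  natK (suc m) = 1# + natK m

  evalMonic : ∀ {n} → Vec Carrier (suc n) → Carrier → Carrier
  evalMonic {n} cs x = pow x (suc n) + go cs 0
    where
    go : ∀ {m} → Vec Carrier m → ℕ → Carrier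
    go []       k = 0#
    go (a ∷ as) k = a * pow x k + go as (suc k)

  -- monic polynomial with coefficients in the prime field (images of naturals)
  evalMonicℕ : ∀ {n} → Vec ℕ (suc n) → Carrier → Carrier
  evalMonicℕ cs x = evalMonic (Data.Vec.map natK cs) x

  -- K is (a model of) the algebraic closure of F_p : a field of characteristic p
  -- that is algebraically closed and algebraic over its prime field F_p.
  -- (The algebraic closure of F_q, q = p^e, coincides with that of F_p.)
  record IsAlgClosureOfFp (p : ℕ) : Set (c ⊔ ℓ) where
    field
      prime       : Prime p
      1≉0         : ¬ (1# ≈ 0#)
      inverse     : ∀ x → ¬ (x ≈ 0#) → ∃ λ y → x * y ≈ 1#
      char-p      : natK p ≈ 0#
      alg-closed  : ∀ {n} (cs : Vec Carrier (suc n)) → ∃ λ x → evalMonic cs x ≈ 0#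
      algebraic   : ∀ x → Σ ℕ λ n → ∃ λ (cs : Vec ℕ (suc n)) → evalMonicℕ cs x ≈ 0#

  f : (q : ℕ) {t : ℕ} → Carrier → Vec Carrier t → Carrier → Carrier
  f q {t} a B x =
    pow a q * x + mid B 1 + pow (- 1#) (suc t) * a * pow x (q ℕ.^ suc t)
    where
    mid : ∀ {m} → Vec Carrier m → ℕ → Carrier
    mid []       k = 0#
    mid (b ∷ bs) k = b * pow x (q ℕ.^ k) + mid bs (suc k)

  SameKernel : (q : ℕ) {t : ℕ} → Carrier → Vec Carrier t → Carrier → Vec Carrier t → Set (c ⊔ ℓ)
  SameKernel q a B c' D =
    ∀ x → (f q a B x ≈ 0# → f q c' D x ≈ 0#) × (f q c' D x ≈ 0# → f q a B x ≈ 0#)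

  InFq : ℕ → Carrier → Set ℓ
  InFq q λ′ = pow λ′ q ≈ λ′

  VecEq : ∀ {t} → Vec Carrier t → Vec Carrier t → Set ℓ
  VecEq []       []       = Data.Unit.Polymorphic.⊤
  VecEq (u ∷ us) (v ∷ vs) = u ≈ v × VecEq us vs

  scale : ∀ {t} → Carrier → Vec Carrier t → Vec Carrier t
  scale λ′ = Data.Vec.map (λ′ *_)

module Submission where

open import Defs
open import Level using (Level; _⊔_)
open import Data.Nat using (ℕ; _^_; _≤_)
open import Data.Vec using (Vec)
open import Data.Product using (∃; _×_)
open import Relation.Nullary using (¬_)
open import Algebra.Bundles using (CommutativeRing)

open import Data.Nat as ℕ using (zero; suc; _<_; z<s; s<s)
import Data.Nat.Properties as ℕ
open import Data.Nat.Primality using (prime⇒nonTrivial)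
open import Data.Fin using (toℕ; fromℕ<)
open import Data.Fin.Properties using (toℕ-fromℕ<)
open import Data.Vec using ([]; _∷_; tabulate; zipWith)
open import Data.Vec.Relation.Unary.All as All using (All; []; _∷_)
open import Data.Vec.Relation.Unary.All.Properties using (tabulate⁻)
open import Data.Vec.Relation.Unary.AllPairs using (AllPairs; []; _∷_)
open import Data.Product using (_,_; proj₁; proj₂)
open import Data.Unit.Polymorphic using (tt)
open import Function using (_∘_)
open import Relation.Binary.PropositionalEquality as ≡ using (_≡_; _≢_)
open import Relation.Nullary using (yes; no; contradiction)

-- Write N = q^(t+1). The polynomial f_{a,B} is linearised: its formal derivative is the
-- constant a^q ≠ 0, because q = 0 in K. So it is separable and, K being algebraically
-- closed, it has N distinct roots. For λ = c/a the polynomial f_{c,D} − λ f_{a,B} has no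
-- x^N term, hence fewer than N coefficients, and it vanishes at these N roots; so it is zero,
-- which says c^q = λ a^q (that is, λ^q = λ) and D = λ B. Conversely, if λ^q = λ then
-- f_{λa,λB} = λ f_{a,B}.

module RingLemmas {c ℓ} (K : CommutativeRing c ℓ) where
  open CommutativeRing K
  open import Relation.Binary.Reasoning.Setoid setoid
  open import Algebra.Solver.Ring.NaturalCoefficients.Default commutativeSemiring
  open import Algebra.Properties.Group +-group using (x∙y⁻¹≈ε⇒x≈y)
  open import Algebra.Properties.Ring ring using (-‿distribˡ-*)
  open import Algebra.Properties.Semiring.Mult semiring using (×1-homo-*) renaming (_×_ to _·1_)

  private variable
    m : ℕ

  pow-cong : ∀ n {u v} → u ≈ v → pow K u n ≈ pow K v n
  pow-cong zero    u≈v = refl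
  pow-cong (suc n) u≈v = *-cong u≈v (pow-cong n u≈v)

  pow-distrib-* : ∀ u v n → pow K (u * v) n ≈ pow K u n * pow K v n
  pow-distrib-* u v zero    = sym (*-identityˡ 1#)
  pow-distrib-* u v (suc n) = begin
    (u * v) * pow K (u * v) n           ≈⟨ *-congˡ (pow-distrib-* u v n) ⟩
    (u * v) * (pow K u n * pow K v n)
      ≈⟨ solve 4 (λ u v U V → (u :* v) :* (U :* V)
                            := (u :* U) :* (v :* V)) refl u v _ _ ⟩
    (u * pow K u n) * (v * pow K v n)   ∎

  natK-suc-* : ∀ n u → natK K (suc n) * u ≈ u + natK K n * u
  natK-suc-* n u = trans (distribʳ u 1# (natK K n)) (+-congʳ (*-identityˡ u))

  natK-1-* : ∀ u → natK K 1 * u ≈ u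
  natK-1-* u = trans (natK-suc-* 0 u) (trans (+-congˡ (zeroˡ u)) (+-identityʳ u))

  natK-* : ∀ m n → natK K (m ℕ.* n) ≈ natK K m * natK K n
  natK-* m n = begin
    natK K (m ℕ.* n)               ≡⟨ natK≡×1 (m ℕ.* n) ⟩
    (m ℕ.* n) ·1 1#                ≈⟨ ×1-homo-* m n ⟩
    (m ·1 1#) * (n ·1 1#)          ≡⟨ ≡.cong₂ _*_ (natK≡×1 m) (natK≡×1 n) ⟨
    natK K m * natK K n            ∎
    where
    natK≡×1 : ∀ m → natK K m ≡ m ·1 1#
    natK≡×1 zero    = ≡.refl
    natK≡×1 (suc m) = ≡.cong (1# +_) (natK≡×1 m)

  ≈0-cancelʳ : ∀ {u v} → u + v ≈ 0# → v ≈ 0# → u ≈ 0#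
  ≈0-cancelʳ {u} {v} u+v≈0 v≈0 = trans (sym (+-identityʳ u)) (trans (+-congˡ (sym v≈0)) u+v≈0)

  ≈0-cancelˡ : ∀ {u v} → u + v ≈ 0# → u ≈ 0# → v ≈ 0#
  ≈0-cancelˡ {u} {v} u+v≈0 = ≈0-cancelʳ (trans (+-comm v u) u+v≈0)

  x*u≈[x-r]*u+r*u : ∀ x r u → x * u ≈ (x - r) * u + r * u
  x*u≈[x-r]*u+r*u x r u = begin
    x * u                    ≈⟨ *-congʳ (sym (+-identityʳ x)) ⟩
    (x + 0#) * u             ≈⟨ *-congʳ (+-congˡ (sym (-‿inverseˡ r))) ⟩
    (x + (- r + r)) * u      ≈⟨ *-congʳ (sym (+-assoc x (- r) r)) ⟩
    ((x - r) + r) * u        ≈⟨ distribʳ u (x - r) r ⟩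
    (x - r) * u + r * u      ∎

  -‿≉0 : ∀ {r s} → r ≉ s → s - r ≉ 0#
  -‿≉0 {r} {s} r≉s s-r≈0 = r≉s (sym (x∙y⁻¹≈ε⇒x≈y s r s-r≈0))

  x+-y*z≈0⇒x≈y*z : ∀ {x y z} → x + - y * z ≈ 0# → x ≈ y * z
  x+-y*z≈0⇒x≈y*z {x} {y} {z} x-yz≈0 = x∙y⁻¹≈ε⇒x≈y x (y * z) (trans (+-congˡ (-‿distribˡ-* y z)) x-yz≈0)

  zipWith-x+-y*z≈0⇒VecEq : ∀ y (xs zs : Vec Carrier m) → All (_≈ 0#) (zipWith _+_ xs (scale K (- y) zs)) →
                           VecEq K xs (scale K y zs)
  zipWith-x+-y*z≈0⇒VecEq y []       []       []               = tt
  zipWith-x+-y*z≈0⇒VecEq y (x ∷ xs) (z ∷ zs) (x-yz≈0 ∷ rest) = x+-y*z≈0⇒x≈y*z x-yz≈0 , zipWith-x+-y*z≈0⇒VecEq y xs zs rest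

  VecEq-refl : (xs : Vec Carrier m) → VecEq K xs xs
  VecEq-refl []       = tt
  VecEq-refl (x ∷ xs) = refl , VecEq-refl xs

module Polynomials {c ℓ} (K : CommutativeRing c ℓ) where
  open CommutativeRing K
  open RingLemmas K
  open import Relation.Binary.Reasoning.Setoid setoid
  open import Algebra.Solver.Ring.NaturalCoefficients.Default commutativeSemiring
  open import Algebra.Properties.CommutativeSemigroup *-commutativeSemigroup using (x∙yz≈y∙xz)

  private variable
    m n : ℕ

  eval : Carrier → Vec Carrier n → Carrier → Carrier
  eval lead []       x = lead
  eval lead (c ∷ cs) x = c + x * eval lead cs x

  derivative : Carrier → Vec Carrier n → Carrier → Carrier
  derivative lead []       x = 0#
  derivative lead (c ∷ cs) x = eval lead cs x + x * derivative lead cs x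

  -- the quotient of eval lead (c ∷ cs) by x - r; it does not depend on c
  quotient : Carrier → Carrier → Vec Carrier n → Vec Carrier n
  quotient lead r []       = []
  quotient lead r (d ∷ ds) = eval lead (d ∷ ds) r ∷ quotient lead r ds

  eval-cong : ∀ {lead} (cs : Vec Carrier n) {x y} → x ≈ y → eval lead cs x ≈ eval lead cs y
  eval-cong []       x≈y = refl
  eval-cong (c ∷ cs) x≈y = +-congˡ (*-cong x≈y (eval-cong cs x≈y))

  -- The ring solver used here works over semirings, so x - r enters its identities as an
  -- atom y, tied to x by x*u≈[x-r]*u+r*u.
  eval-quotient : ∀ lead r c (cs : Vec Carrier n) x →
                  eval lead (c ∷ cs) x ≈ (x - r) * eval lead (quotient lead r cs) x + eval lead (c ∷ cs) r
  eval-quotient lead r c [] x = begin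
    c + x * lead
      ≈⟨ +-congˡ (x*u≈[x-r]*u+r*u x r lead) ⟩
    c + ((x - r) * lead + r * lead)
      ≈⟨ solve 4 (λ c y r l → c :+ (y :* l :+ r :* l)
                            := y :* l :+ (c :+ r :* l)) refl c (x - r) r lead ⟩
    (x - r) * lead + (c + r * lead)  ∎
  eval-quotient lead r c (d ∷ ds) x = begin
    c + x * eval lead (d ∷ ds) x
      ≈⟨ +-congˡ (*-congˡ (eval-quotient lead r d ds x)) ⟩
    c + x * ((x - r) * T + ρ)
      ≈⟨ solve 5 (λ c x y T ρ → c :+ x :* (y :* T :+ ρ)
                              := c :+ x :* (y :* T) :+ x :* ρ) refl c x (x - r) T ρ ⟩
    c + x * ((x - r) * T) + x * ρ
      ≈⟨ +-congˡ (x*u≈[x-r]*u+r*u x r ρ) ⟩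
    c + x * ((x - r) * T) + ((x - r) * ρ + r * ρ)
      ≈⟨ solve 6 (λ c x y r T ρ → c :+ x :* (y :* T) :+ (y :* ρ :+ r :* ρ)
                                := y :* (ρ :+ x :* T) :+ (c :+ r :* ρ)) refl c x (x - r) r T ρ ⟩
    (x - r) * (ρ + x * T) + (c + r * ρ)  ∎
    where
    T = eval lead (quotient lead r ds) x
    ρ = eval lead (d ∷ ds) r

  derivative-quotient : ∀ lead r c (cs : Vec Carrier n) x →
                        derivative lead (c ∷ cs) x ≈ eval lead (quotient lead r cs) x + (x - r) * derivative lead (quotient lead r cs) x
  derivative-quotient lead r c [] x = +-congˡ (trans (zeroʳ x) (sym (zeroʳ (x - r))))
  derivative-quotient lead r c (d ∷ ds) x = begin
    eval lead (d ∷ ds) x + x * derivative lead (d ∷ ds) x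
      ≈⟨ +-cong (eval-quotient lead r d ds x) (*-congˡ (derivative-quotient lead r d ds x)) ⟩
    ((x - r) * Q + ρ) + x * (Q + (x - r) * Q′)
      ≈⟨ solve 5 (λ x y Q ρ Q′ → (y :* Q :+ ρ) :+ x :* (Q :+ y :* Q′)
                               := (ρ :+ x :* Q) :+ y :* (Q :+ x :* Q′)) refl x (x - r) Q ρ Q′ ⟩
    (ρ + x * Q) + (x - r) * (Q + x * Q′)   ∎
    where
    Q  = eval lead (quotient lead r ds) x
    Q′ = derivative lead (quotient lead r ds) x
    ρ  = eval lead (d ∷ ds) r

  Separable : Carrier → Vec Carrier n → Set (c ⊔ ℓ)
  Separable lead cs = ∀ s → eval lead cs s ≈ 0# → derivative lead cs s ≉ 0#

  module _ {lead r} (c : Carrier) (cs : Vec Carrier n) (P[r]≈0 : eval lead (c ∷ cs) r ≈ 0#) where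

    quotient-root⇒root : ∀ {s} → eval lead (quotient lead r cs) s ≈ 0# → eval lead (c ∷ cs) s ≈ 0#
    quotient-root⇒root {s} Q[s]≈0 = begin
      eval lead (c ∷ cs) s
        ≈⟨ eval-quotient lead r c cs s ⟩
      (s - r) * eval lead (quotient lead r cs) s + eval lead (c ∷ cs) r
        ≈⟨ +-cong (*-congˡ Q[s]≈0) P[r]≈0 ⟩
      (s - r) * 0# + 0#
        ≈⟨ trans (+-identityʳ _) (zeroʳ _) ⟩
      0#  ∎

    quotient-separable : Separable lead (c ∷ cs) → Separable lead (quotient lead r cs)
    quotient-separable separable s Q[s]≈0 Q′[s]≈0 = separable s (quotient-root⇒root Q[s]≈0) (begin
      derivative lead (c ∷ cs) s
        ≈⟨ derivative-quotient lead r c cs s ⟩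
      eval lead (quotient lead r cs) s + (s - r) * derivative lead (quotient lead r cs) s
        ≈⟨ +-cong Q[s]≈0 (*-congˡ Q′[s]≈0) ⟩
      0# + (s - r) * 0#
        ≈⟨ trans (+-identityˡ _) (zeroʳ _) ⟩
      0#  ∎)

    quotient-nonzero-at-root : Separable lead (c ∷ cs) → eval lead (quotient lead r cs) r ≉ 0#
    quotient-nonzero-at-root separable Q[r]≈0 = separable r P[r]≈0 (begin
      derivative lead (c ∷ cs) r
        ≈⟨ derivative-quotient lead r c cs r ⟩
      eval lead (quotient lead r cs) r + (r - r) * derivative lead (quotient lead r cs) r
        ≈⟨ +-cong Q[r]≈0 (*-congʳ (-‿inverseʳ r)) ⟩
      0# + 0# * derivative lead (quotient lead r cs) r
        ≈⟨ trans (+-identityˡ _) (zeroˡ _) ⟩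
      0#  ∎)

  zero-quotient⇒zero : ∀ {r} c (cs : Vec Carrier n) → eval 0# (c ∷ cs) r ≈ 0# →
                       All (_≈ 0#) (quotient 0# r cs) → All (_≈ 0#) (c ∷ cs)
  zero-quotient⇒zero {r = r} c []       P[r]≈0 []          = ≈0-cancelʳ P[r]≈0 (zeroʳ r) ∷ []
  zero-quotient⇒zero {r = r} c (d ∷ ds) P[r]≈0 (h≈0 ∷ hs≈0) =
    ≈0-cancelʳ P[r]≈0 (trans (*-congˡ h≈0) (zeroʳ r)) ∷ zero-quotient⇒zero d ds h≈0 hs≈0

  module _ (root : ∀ {n} c (cs : Vec Carrier n) → ∃ λ x → eval 1# (c ∷ cs) x ≈ 0#) where

    separable⇒distinct-roots : (cs : Vec Carrier n) → Separable 1# cs →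
                               ∃ λ (rs : Vec Carrier n) → AllPairs _≉_ rs × All (λ r → eval 1# cs r ≈ 0#) rs
    separable⇒distinct-roots []       _         = [] , [] , []
    separable⇒distinct-roots (c ∷ cs) separable with root c cs
    ... | r , P[r]≈0 with separable⇒distinct-roots (quotient 1# r cs) (quotient-separable c cs P[r]≈0 separable)
    ... | rs , distinct , Q[rs]≈0 =
      r ∷ rs , All.map r≉root Q[rs]≈0 ∷ distinct , P[r]≈0 ∷ All.map (quotient-root⇒root c cs P[r]≈0) Q[rs]≈0
      where
      r≉root : ∀ {s} → eval 1# (quotient 1# r cs) s ≈ 0# → r ≉ s
      r≉root Q[s]≈0 r≈s = quotient-nonzero-at-root c cs P[r]≈0 separable (trans (eval-cong (quotient 1# r cs) r≈s) Q[s]≈0)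

  coefficients : ∀ n → (ℕ → Carrier) → Vec Carrier n
  coefficients n g = tabulate (g ∘ toℕ)

  coefficients-zero : ∀ n {g} → All (_≈ 0#) (coefficients n g) → ∀ {i} → i < n → g i ≈ 0#
  coefficients-zero n {g} zeros i<n = ≡.subst (λ j → g j ≈ 0#) (toℕ-fromℕ< i<n) (tabulate⁻ zeros (fromℕ< i<n))

  eval-cong-lead : ∀ (cs : Vec Carrier n) x {l l′} → l ≈ l′ → eval l cs x ≈ eval l′ cs x
  eval-cong-lead []       x l≈l′ = l≈l′
  eval-cong-lead (c ∷ cs) x l≈l′ = +-congˡ (*-congˡ (eval-cong-lead cs x l≈l′))

  eval-coefficients-cong : ∀ n {l l′ g h} x → l ≈ l′ → (∀ i → g i ≈ h i) →
                           eval l (coefficients n g) x ≈ eval l′ (coefficients n h) x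
  eval-coefficients-cong zero    x l≈l′ g≈h = l≈l′
  eval-coefficients-cong (suc n) x l≈l′ g≈h = +-cong (g≈h 0) (*-congˡ (eval-coefficients-cong n x l≈l′ (g≈h ∘ suc)))

  eval-coefficients-+ : ∀ n l l′ g h x → eval (l + l′) (coefficients n (λ i → g i + h i)) x
                                         ≈ eval l (coefficients n g) x + eval l′ (coefficients n h) x
  eval-coefficients-+ zero    l l′ g h x = refl
  eval-coefficients-+ (suc n) l l′ g h x = begin
    (g 0 + h 0) + x * eval (l + l′) (coefficients n (λ i → g (suc i) + h (suc i))) x
      ≈⟨ +-congˡ (*-congˡ (eval-coefficients-+ n l l′ (g ∘ suc) (h ∘ suc) x)) ⟩
    (g 0 + h 0) + x * (E + E′)
      ≈⟨ solve 5 (λ a b x E E′ → (a :+ b) :+ x :* (E :+ E′)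
                               := (a :+ x :* E) :+ (b :+ x :* E′)) refl (g 0) (h 0) x E E′ ⟩
    (g 0 + x * E) + (h 0 + x * E′)  ∎
    where
    E  = eval l (coefficients n (g ∘ suc)) x
    E′ = eval l′ (coefficients n (h ∘ suc)) x

  eval-lead : ∀ lead (cs : Vec Carrier n) x → eval lead cs x ≈ eval 0# cs x + lead * pow K x n
  eval-lead lead []       x = sym (trans (+-identityˡ _) (*-identityʳ lead))
  eval-lead {suc n} lead (c ∷ cs) x = begin
    c + x * eval lead cs x                            ≈⟨ +-congˡ (*-congˡ (eval-lead lead cs x)) ⟩
    c + x * (eval 0# cs x + lead * pow K x n)
      ≈⟨ solve 5 (λ c x E l X → c :+ x :* (E :+ l :* X)
                              := (c :+ x :* E) :+ l :* (x :* X)) refl c x (eval 0# cs x) lead (pow K x n) ⟩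
    (c + x * eval 0# cs x) + lead * (x * pow K x n)   ∎

  eval-coefficients-0 : ∀ n x → eval 0# (coefficients n (λ _ → 0#)) x ≈ 0#
  eval-coefficients-0 zero    x = refl
  eval-coefficients-0 (suc n) x = trans (+-identityˡ _) (trans (*-congˡ (eval-coefficients-0 n x)) (zeroʳ x))

  monomial : ℕ → Carrier → ℕ → Carrier
  monomial zero    c zero    = c
  monomial zero    c (suc i) = 0#
  monomial (suc j) c zero    = 0#
  monomial (suc j) c (suc i) = monomial j c i

  monomial-diagonal : ∀ j c → monomial j c j ≡ c
  monomial-diagonal zero    c = ≡.refl
  monomial-diagonal (suc j) c = monomial-diagonal j c

  monomial-off-diagonal : ∀ {i j} c → i ≢ j → monomial j c i ≡ 0#
  monomial-off-diagonal {zero}  {zero}  c i≢j = contradiction ≡.refl i≢j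
  monomial-off-diagonal {zero}  {suc j} c i≢j = ≡.refl
  monomial-off-diagonal {suc i} {zero}  c i≢j = ≡.refl
  monomial-off-diagonal {suc i} {suc j} c i≢j = monomial-off-diagonal c (i≢j ∘ ≡.cong suc)

  monomial-≈0 : ∀ j {c} i → c ≈ 0# → monomial j c i ≈ 0#
  monomial-≈0 zero    zero    c≈0 = c≈0
  monomial-≈0 zero    (suc i) c≈0 = refl
  monomial-≈0 (suc j) zero    c≈0 = refl
  monomial-≈0 (suc j) (suc i) c≈0 = monomial-≈0 j i c≈0

  natK-*-monomial : ∀ i j c → natK K i * monomial j c i ≈ natK K j * monomial j c i
  natK-*-monomial i j c with i ℕ.≟ j
  ... | yes ≡.refl = refl
  ... | no  i≢j    = begin
    natK K i * monomial j c i   ≡⟨ ≡.cong (natK K i *_) (monomial-off-diagonal c i≢j) ⟩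
    natK K i * 0#               ≈⟨ zeroʳ _ ⟩
    0#                          ≈⟨ zeroʳ _ ⟨
    natK K j * 0#               ≡⟨ ≡.cong (natK K j *_) (monomial-off-diagonal c i≢j) ⟨
    natK K j * monomial j c i   ∎

  eval-monomial : ∀ {n j} c x → j < n → eval 0# (coefficients n (monomial j c)) x ≈ c * pow K x j
  eval-monomial {suc n} {zero}  c x _ = begin
    c + x * eval 0# (coefficients n (λ _ → 0#)) x   ≈⟨ +-congˡ (*-congˡ (eval-coefficients-0 n x)) ⟩
    c + x * 0#                                      ≈⟨ +-congˡ (zeroʳ x) ⟩
    c + 0#                                          ≈⟨ +-identityʳ c ⟩
    c                                               ≈⟨ *-identityʳ c ⟨
    c * 1#                                          ∎
  eval-monomial {suc n} {suc j} c x (s<s j<n) = begin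
    0# + x * eval 0# (coefficients n (monomial j c)) x   ≈⟨ +-identityˡ _ ⟩
    x * eval 0# (coefficients n (monomial j c)) x        ≈⟨ *-congˡ (eval-monomial c x j<n) ⟩
    x * (c * pow K x j)                                  ≈⟨ x∙yz≈y∙xz x c _ ⟩
    c * (x * pow K x j)                                  ∎

  derivative-coefficients : ∀ n lead g x →
    derivative lead (coefficients n g) x ≈ eval (natK K n * lead) (coefficients (ℕ.pred n) (λ i → natK K (suc i) * g (suc i))) x
  derivative-coefficients zero          lead g x = sym (zeroˡ lead)
  derivative-coefficients (suc zero)    lead g x = begin
    lead + x * 0#            ≈⟨ +-congˡ (zeroʳ x) ⟩
    lead + 0#                ≈⟨ +-congˡ (zeroˡ lead) ⟨
    lead + 0# * lead         ≈⟨ natK-suc-* 0 lead ⟨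
    natK K 1 * lead          ∎
  derivative-coefficients (suc (suc n)) lead g x = begin
    (g 1 + x * E) + x * derivative lead (coefficients (suc n) (g ∘ suc)) x
      ≈⟨ +-congˡ (*-congˡ (derivative-coefficients (suc n) lead (g ∘ suc) x)) ⟩
    (g 1 + x * E) + x * E′
      ≈⟨ solve 4 (λ a x E E′ → (a :+ x :* E) :+ x :* E′ := a :+ x :* (E :+ E′)) refl (g 1) x E E′ ⟩
    g 1 + x * (E + E′)
      ≈⟨ +-congˡ (*-congˡ (eval-coefficients-+ n lead (natK K (suc n) * lead) g″ h x)) ⟨
    g 1 + x * eval (lead + natK K (suc n) * lead) (coefficients n (λ i → g″ i + h i)) x
      ≈⟨ +-cong (natK-1-* (g 1)) (*-congˡ (eval-coefficients-cong n x (natK-suc-* (suc n) lead) (λ i → natK-suc-* (suc i) (g″ i)))) ⟨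
    natK K 1 * g 1 + x * eval (natK K (suc (suc n)) * lead) (coefficients n (λ i → natK K (suc (suc i)) * g″ i)) x  ∎
    where
    g″ = g ∘ suc ∘ suc
    h  = λ i → natK K (suc i) * g″ i
    E  = eval lead (coefficients n g″) x
    E′ = eval (natK K (suc n) * lead) (coefficients n h) x

  powerSum : (ℕ → ℕ) → Carrier → Vec Carrier m → ℕ → Carrier
  powerSum e x []       k = 0#
  powerSum e x (b ∷ bs) k = b * pow K x (e k) + powerSum e x bs (suc k)

  -- Defs.f and Defs.evalMonic compute their middle sums with where-bound helpers, which
  -- cannot be named. Such a helper satisfies the defining equations of powerSum, and it is
  -- found by unification at a use site whose arguments have been abstracted by 'with'.
  module _ (e : ℕ → ℕ) (x : Carrier) {O : ℕ → Set c} (h : ∀ {n} → O n → ∀ {m} → Vec Carrier m → ℕ → Carrier)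
    (h-[] : ∀ {n} (o : O n) k → h o [] k ≡ 0#)
    (h-∷ : ∀ {n} (o : O n) {m} b (bs : Vec Carrier m) k → h o (b ∷ bs) k ≡ b * pow K x (e k) + h o bs (suc k))
    where

    powerSum-unique : ∀ {n} (o : O n) {m} (bs : Vec Carrier m) k → h o bs k ≡ powerSum e x bs k
    powerSum-unique o []       k = h-[] o k
    powerSum-unique o (b ∷ bs) k = ≡.trans (h-∷ o b bs k) (≡.cong (b * pow K x (e k) +_) (powerSum-unique o bs (suc k)))

  powerSum-id-eval : ∀ lead (cs : Vec Carrier n) x k → powerSum (λ i → i) x cs k + lead * pow K x (k ℕ.+ n) ≈ pow K x k * eval lead cs x
  powerSum-id-eval lead [] x k = begin
    0# + lead * pow K x (k ℕ.+ 0)   ≈⟨ +-identityˡ _ ⟩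
    lead * pow K x (k ℕ.+ 0)        ≡⟨ ≡.cong (λ j → lead * pow K x j) (ℕ.+-identityʳ k) ⟩
    lead * pow K x k                ≈⟨ *-comm lead _ ⟩
    pow K x k * lead                ∎
  powerSum-id-eval lead (c ∷ cs) x k = begin
    (c * X + powerSum (λ i → i) x cs (suc k)) + lead * pow K x (k ℕ.+ suc _)
      ≡⟨ ≡.cong (λ j → (c * X + powerSum (λ i → i) x cs (suc k)) + lead * pow K x j) (ℕ.+-suc k _) ⟩
    (c * X + powerSum (λ i → i) x cs (suc k)) + lead * pow K x (suc k ℕ.+ _)
      ≈⟨ +-assoc _ _ _ ⟩
    c * X + (powerSum (λ i → i) x cs (suc k) + lead * pow K x (suc k ℕ.+ _))
      ≈⟨ +-congˡ (powerSum-id-eval lead cs x (suc k)) ⟩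
    c * X + (x * X) * eval lead cs x
      ≈⟨ solve 4 (λ c X x E → c :* X :+ (x :* X) :* E := X :* (c :+ x :* E)) refl c X x (eval lead cs x) ⟩
    X * (c + x * eval lead cs x)   ∎
    where
    X = pow K x k

  evalMonic-unfold : ∀ x {n} (cs : Vec Carrier (suc n)) → evalMonic K cs x ≡ pow K x (suc n) + powerSum (λ i → i) x cs 0
  evalMonic-unfold x with powerSum-unique (λ i → i) x {λ n → Vec Carrier (suc n)} _ (λ _ _ → ≡.refl) (λ _ _ _ _ → ≡.refl)
  ... | go≡powerSum = unfold
    where
    unfold : ∀ {n} (cs : Vec Carrier (suc n)) → evalMonic K cs x ≡ pow K x (suc n) + powerSum (λ i → i) x cs 0
    unfold (c ∷ [])                      = ≡.refl
    unfold {suc n} cs@(_ ∷ _ ∷ ds) with suc n | cs | 2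
    ... | _ | outer | k = ≡.cong (λ z → _ + (_ + (_ + z))) (go≡powerSum outer ds k)

  evalMonic≈eval : ∀ x (cs : Vec Carrier (suc n)) → evalMonic K cs x ≈ eval 1# cs x
  evalMonic≈eval {n} x cs = begin
    evalMonic K cs x                                           ≡⟨ evalMonic-unfold x cs ⟩
    pow K x (suc n) + powerSum (λ i → i) x cs 0                ≈⟨ +-comm _ _ ⟩
    powerSum (λ i → i) x cs 0 + pow K x (suc n)                ≈⟨ +-congˡ (*-identityˡ _) ⟨
    powerSum (λ i → i) x cs 0 + 1# * pow K x (suc n)           ≈⟨ powerSum-id-eval 1# cs x 0 ⟩
    1# * eval 1# cs x                                          ≈⟨ *-identityˡ _ ⟩
    eval 1# cs x                                               ∎

  powerSum-cong : ∀ e x {bs bs′ : Vec Carrier m} k → VecEq K bs bs′ → powerSum e x bs k ≈ powerSum e x bs′ k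
  powerSum-cong e x {[]}     {[]}       k _              = refl
  powerSum-cong e x {b ∷ bs} {b′ ∷ bs′} k (b≈b′ , bs≈bs′) = +-cong (*-congʳ b≈b′) (powerSum-cong e x (suc k) bs≈bs′)

  powerSum-scale : ∀ e x u (bs : Vec Carrier m) k → u * powerSum e x bs k ≈ powerSum e x (scale K u bs) k
  powerSum-scale e x u []       k = zeroʳ u
  powerSum-scale e x u (b ∷ bs) k = begin
    u * (b * X + powerSum e x bs (suc k))            ≈⟨ distribˡ u _ _ ⟩
    u * (b * X) + u * powerSum e x bs (suc k)        ≈⟨ +-cong (sym (*-assoc u b X)) (powerSum-scale e x u bs (suc k)) ⟩
    u * b * X + powerSum e x (scale K u bs) (suc k)  ∎
    where
    X = pow K x (e k)

  powerSum-+ : ∀ e x (bs bs′ : Vec Carrier m) k → powerSum e x bs k + powerSum e x bs′ k ≈ powerSum e x (zipWith _+_ bs bs′) k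
  powerSum-+ e x []       []         k = +-identityˡ 0#
  powerSum-+ e x (b ∷ bs) (b′ ∷ bs′) k = begin
    (b * X + S) + (b′ * X + S′)
      ≈⟨ solve 5 (λ b b′ X S S′ → (b :* X :+ S) :+ (b′ :* X :+ S′)
                                := (b :+ b′) :* X :+ (S :+ S′)) refl b b′ X S S′ ⟩
    (b + b′) * X + (S + S′)
      ≈⟨ +-congˡ (powerSum-+ e x bs bs′ (suc k)) ⟩
    (b + b′) * X + powerSum e x (zipWith _+_ bs bs′) (suc k)  ∎
    where
    X  = pow K x (e k)
    S  = powerSum e x bs (suc k)
    S′ = powerSum e x bs′ (suc k)

module Linearised {c ℓ} (K : CommutativeRing c ℓ) (q : ℕ) where
  open CommutativeRing K
  open RingLemmas K
  open Polynomials K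
  open import Relation.Binary.Reasoning.Setoid setoid
  open import Algebra.Solver.Ring.NaturalCoefficients.Default commutativeSemiring

  private variable
    m : ℕ

  linearised : Carrier → Vec Carrier m → Carrier → Carrier → Carrier
  linearised {m} α B β x = α * x + powerSum (q ^_) x B 1 + β * pow K x (q ^ suc m)

  f≡linearised : ∀ a x (B : Vec Carrier m) → f K q a B x ≡ linearised (pow K a q) B (pow K (- 1#) (suc m) * a) x
  f≡linearised a x with powerSum-unique (q ^_) x {Vec Carrier} _ (λ _ _ → ≡.refl) (λ _ _ _ _ → ≡.refl)
  ... | mid≡powerSum = unfold
    where
    unfold : ∀ {m} (B : Vec Carrier m) → f K q a B x ≡ linearised (pow K a q) B (pow K (- 1#) (suc m) * a) x
    unfold []                  = ≡.refl
    unfold {suc m} B@(_ ∷ bs) with suc m | B | 2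
    ... | _ | outer | k = ≡.cong (λ z → _ + (_ + z) + _) (mid≡powerSum outer bs k)

  linearised-cong : ∀ {α α′ β β′} {B B′ : Vec Carrier m} x → α ≈ α′ → VecEq K B B′ → β ≈ β′ →
                    linearised α B β x ≈ linearised α′ B′ β′ x
  linearised-cong x α≈α′ B≈B′ β≈β′ = +-cong (+-cong (*-congʳ α≈α′) (powerSum-cong (q ^_) x 1 B≈B′)) (*-congʳ β≈β′)

  linearised-scale : ∀ u α (B : Vec Carrier m) β x → u * linearised α B β x ≈ linearised (u * α) (scale K u B) (u * β) x
  linearised-scale {m} u α B β x = begin
    u * (α * x + S + β * X)
      ≈⟨ solve 6 (λ u α x S β X → u :* (α :* x :+ S :+ β :* X)
                                := u :* α :* x :+ u :* S :+ u :* β :* X) refl u α x S β X ⟩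
    u * α * x + u * S + u * β * X       ≈⟨ +-congʳ (+-congˡ (powerSum-scale (q ^_) x u B 1)) ⟩
    u * α * x + powerSum (q ^_) x (scale K u B) 1 + u * β * X  ∎
    where
    S = powerSum (q ^_) x B 1
    X = pow K x (q ^ suc m)

  linearised-+ : ∀ α α′ (B B′ : Vec Carrier m) β β′ x →
                 linearised α B β x + linearised α′ B′ β′ x ≈ linearised (α + α′) (zipWith _+_ B B′) (β + β′) x
  linearised-+ {m} α α′ B B′ β β′ x = begin
    (α * x + S + β * X) + (α′ * x + S′ + β′ * X)
      ≈⟨ solve 8 (λ α α′ x S S′ β β′ X → (α :* x :+ S :+ β :* X) :+ (α′ :* x :+ S′ :+ β′ :* X)
                                       := (α :+ α′) :* x :+ (S :+ S′) :+ (β :+ β′) :* X) refl α α′ x S S′ β β′ X ⟩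
    (α + α′) * x + (S + S′) + (β + β′) * X
      ≈⟨ +-congʳ (+-congˡ (powerSum-+ (q ^_) x B B′ 1)) ⟩
    (α + α′) * x + powerSum (q ^_) x (zipWith _+_ B B′) 1 + (β + β′) * X  ∎
    where
    S  = powerSum (q ^_) x B 1
    S′ = powerSum (q ^_) x B′ 1
    X  = pow K x (q ^ suc m)

  termCoefficients : Vec Carrier m → ℕ → ℕ → Carrier
  termCoefficients []       k i = 0#
  termCoefficients (b ∷ bs) k i = monomial (q ^ k) b i + termCoefficients bs (suc k) i

  linearisedCoefficients : Carrier → Vec Carrier m → ℕ → Carrier
  linearisedCoefficients α B i = monomial 1 α i + termCoefficients B 1 i

  module _ (1<q : 1 < q) where

    q^-< : ∀ {k k′} → k < k′ → q ^ k < q ^ k′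
    q^-< = ℕ.^-monoʳ-< q 1<q

    eval-termCoefficients : ∀ {n} (bs : Vec Carrier m) k x → q ^ (k ℕ.+ m) ≤ n →
                            eval 0# (coefficients n (termCoefficients bs k)) x ≈ powerSum (q ^_) x bs k
    eval-termCoefficients {n = n} []                 k x _ = eval-coefficients-0 n x
    eval-termCoefficients {n = n} (_∷_ {m} b bs) k x q^[k+m]≤n = begin
      eval 0# (coefficients n (termCoefficients (b ∷ bs) k)) x
        ≈⟨ eval-cong-lead (coefficients n (termCoefficients (b ∷ bs) k)) x (sym (+-identityʳ 0#)) ⟩
      eval (0# + 0#) (coefficients n (termCoefficients (b ∷ bs) k)) x
        ≈⟨ eval-coefficients-+ n 0# 0# (monomial (q ^ k) b) (termCoefficients bs (suc k)) x ⟩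
      eval 0# (coefficients n (monomial (q ^ k) b)) x + eval 0# (coefficients n (termCoefficients bs (suc k))) x
        ≈⟨ +-cong (eval-monomial b x (ℕ.<-≤-trans (q^-< (ℕ.m<m+n k z<s)) q^[k+m]≤n))
                  (eval-termCoefficients bs (suc k) x (≡.subst (λ j → q ^ j ≤ n) (ℕ.+-suc k m) q^[k+m]≤n)) ⟩
      b * pow K x (q ^ k) + powerSum (q ^_) x bs (suc k)   ∎

    eval-linearisedCoefficients : ∀ α (B : Vec Carrier m) β x →
                                  eval β (coefficients (q ^ suc m) (linearisedCoefficients α B)) x ≈ linearised α B β x
    eval-linearisedCoefficients {m} α B β x = begin
      eval β (coefficients N (linearisedCoefficients α B)) x
        ≈⟨ eval-lead β (coefficients N (linearisedCoefficients α B)) x ⟩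
      eval 0# (coefficients N (linearisedCoefficients α B)) x + β * X
        ≈⟨ +-congʳ (eval-cong-lead (coefficients N (linearisedCoefficients α B)) x (sym (+-identityʳ 0#))) ⟩
      eval (0# + 0#) (coefficients N (linearisedCoefficients α B)) x + β * X
        ≈⟨ +-congʳ (eval-coefficients-+ N 0# 0# (monomial 1 α) (termCoefficients B 1) x) ⟩
      eval 0# (coefficients N (monomial 1 α)) x + eval 0# (coefficients N (termCoefficients B 1)) x + β * X
        ≈⟨ +-congʳ (+-cong (eval-monomial α x (q^-< {k′ = suc m} z<s)) (eval-termCoefficients {n = N} B 1 x ℕ.≤-refl)) ⟩
      α * (x * 1#) + powerSum (q ^_) x B 1 + β * X
        ≈⟨ +-congʳ (+-congʳ (*-congˡ (*-identityʳ x))) ⟩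
      α * x + powerSum (q ^_) x B 1 + β * X   ∎
      where
      N = q ^ suc m
      X = pow K x N

    termCoefficients-below : ∀ (bs : Vec Carrier m) k {i} → i < q ^ k → termCoefficients bs k i ≈ 0#
    termCoefficients-below []       k i<q^k = refl
    termCoefficients-below (b ∷ bs) k i<q^k = begin
      monomial (q ^ k) b _ + termCoefficients bs (suc k) _   ≡⟨ ≡.cong (_+ _) (monomial-off-diagonal b (ℕ.<⇒≢ i<q^k)) ⟩
      0# + termCoefficients bs (suc k) _                     ≈⟨ +-identityˡ _ ⟩
      termCoefficients bs (suc k) _                          ≈⟨ termCoefficients-below bs (suc k) (ℕ.<-trans i<q^k (q^-< (ℕ.n<1+n k))) ⟩
      0#                                                     ∎

    termCoefficients-vanish : ∀ {n} (bs : Vec Carrier m) k → q ^ (k ℕ.+ m) ≤ n →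
                              (∀ {i} → i < n → termCoefficients bs k i ≈ 0#) → All (_≈ 0#) bs
    termCoefficients-vanish []             k _          _     = []
    termCoefficients-vanish {n = n} (_∷_ {m} b bs) k q^[k+m]≤n zeros = b≈0 ∷ termCoefficients-vanish bs (suc k)
      (≡.subst (λ j → q ^ j ≤ n) (ℕ.+-suc k m) q^[k+m]≤n)
      (λ {i} i<n → ≈0-cancelˡ (zeros i<n) (monomial-≈0 (q ^ k) i b≈0))
      where
      b≈0 : b ≈ 0#
      b≈0 = ≈0-cancelʳ
        (≡.subst (λ u → u + termCoefficients bs (suc k) (q ^ k) ≈ 0#) (monomial-diagonal (q ^ k) b)
                 (zeros (ℕ.<-≤-trans (q^-< (ℕ.m<m+n k z<s)) q^[k+m]≤n)))
        (termCoefficients-below bs (suc k) (q^-< (ℕ.n<1+n k)))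

    linearisedCoefficients-vanish : ∀ α (B : Vec Carrier m) →
      (∀ {i} → i < q ^ suc m → linearisedCoefficients α B i ≈ 0#) → α ≈ 0# × All (_≈ 0#) B
    linearisedCoefficients-vanish {m} α B zeros = α≈0 , termCoefficients-vanish B 1 ℕ.≤-refl
      (λ {i} i<N → ≈0-cancelˡ (zeros i<N) (monomial-≈0 1 i α≈0))
      where
      α≈0 : α ≈ 0#
      α≈0 = ≈0-cancelʳ (zeros (q^-< {k′ = suc m} z<s)) (termCoefficients-below B 1 (q^-< {k′ = 1} z<s))

    module _ (q≈0 : natK K q ≈ 0#) where

      natK-q^suc : ∀ k → natK K (q ^ suc k) ≈ 0#
      natK-q^suc k = trans (natK-* q (q ^ k)) (trans (*-congʳ q≈0) (zeroˡ _))

      natK-*-termCoefficients : ∀ (bs : Vec Carrier m) k i → natK K i * termCoefficients bs (suc k) i ≈ 0#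
      natK-*-termCoefficients []       k i = zeroʳ _
      natK-*-termCoefficients (b ∷ bs) k i = begin
        natK K i * (monomial (q ^ suc k) b i + termCoefficients bs (suc (suc k)) i)
          ≈⟨ distribˡ _ _ _ ⟩
        natK K i * monomial (q ^ suc k) b i + natK K i * termCoefficients bs (suc (suc k)) i
          ≈⟨ +-cong (natK-*-monomial i (q ^ suc k) b) (natK-*-termCoefficients bs (suc k) i) ⟩
        natK K (q ^ suc k) * monomial (q ^ suc k) b i + 0#
          ≈⟨ +-congʳ (trans (*-congʳ (natK-q^suc k)) (zeroˡ _)) ⟩
        0# + 0#
          ≈⟨ +-identityʳ 0# ⟩
        0#  ∎

      derivative-linearisedCoefficients : ∀ α (B : Vec Carrier m) β x →
                                          derivative β (coefficients (q ^ suc m) (linearisedCoefficients α B)) x ≈ α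
      derivative-linearisedCoefficients {m} α B β x = begin
        derivative β (coefficients N (linearisedCoefficients α B)) x
          ≈⟨ derivative-coefficients N β (linearisedCoefficients α B) x ⟩
        eval (natK K N * β) (coefficients (ℕ.pred N) (λ i → natK K (suc i) * linearisedCoefficients α B (suc i))) x
          ≈⟨ eval-coefficients-cong (ℕ.pred N) x (trans (*-congʳ (natK-q^suc m)) (zeroˡ β)) coefficient ⟩
        eval 0# (coefficients (ℕ.pred N) (monomial 0 α)) x
          ≈⟨ eval-monomial α x (ℕ.pred-mono-≤ (q^-< {k′ = suc m} z<s)) ⟩
        α * 1#
          ≈⟨ *-identityʳ α ⟩
        α  ∎
        where
        N = q ^ suc m
        coefficient : ∀ i → natK K (suc i) * linearisedCoefficients α B (suc i) ≈ monomial 0 α i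
        coefficient i = begin
          natK K (suc i) * (monomial 0 α i + termCoefficients B 1 (suc i))
            ≈⟨ distribˡ _ _ _ ⟩
          natK K (suc i) * monomial 0 α i + natK K (suc i) * termCoefficients B 1 (suc i)
            ≈⟨ +-cong (natK-*-monomial (suc i) 1 α) (natK-*-termCoefficients B 0 (suc i)) ⟩
          natK K 1 * monomial 0 α i + 0#
            ≈⟨ +-identityʳ _ ⟩
          natK K 1 * monomial 0 α i
            ≈⟨ natK-1-* _ ⟩
          monomial 0 α i  ∎

module _ {c ℓ} (K : CommutativeRing c ℓ) where
  open CommutativeRing K

  record IsField : Set (c ⊔ ℓ) where
    field
      1≉0     : 1# ≉ 0#
      inverse : ∀ x → x ≉ 0# → ∃ λ y → x * y ≈ 1#

module Field {c ℓ} {K : CommutativeRing c ℓ} (isField : IsField K) where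
  open CommutativeRing K
  open IsField isField
  open RingLemmas K
  open Polynomials K
  open import Relation.Binary.Reasoning.Setoid setoid

  *-cancelʳ-≉0 : ∀ {u v w} → v ≉ 0# → u * v ≈ w * v → u ≈ w
  *-cancelʳ-≉0 {u} {v} {w} v≉0 uv≈wv with inverse v v≉0
  ... | y , vy≈1 = begin
    u              ≈⟨ *-identityʳ u ⟨
    u * 1#         ≈⟨ *-congˡ vy≈1 ⟨
    u * (v * y)    ≈⟨ *-assoc u v y ⟨
    (u * v) * y    ≈⟨ *-congʳ uv≈wv ⟩
    (w * v) * y    ≈⟨ *-assoc w v y ⟩
    w * (v * y)    ≈⟨ *-congˡ vy≈1 ⟩
    w * 1#         ≈⟨ *-identityʳ w ⟩
    w              ∎

  *-cancelˡ-≉0 : ∀ {u v} → u ≉ 0# → u * v ≈ 0# → v ≈ 0#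
  *-cancelˡ-≉0 {u} {v} u≉0 uv≈0 = *-cancelʳ-≉0 u≉0 (trans (*-comm v u) (trans uv≈0 (sym (zeroˡ u))))

  *-≉0 : ∀ {u v} → u ≉ 0# → v ≉ 0# → u * v ≉ 0#
  *-≉0 u≉0 v≉0 uv≈0 = v≉0 (*-cancelˡ-≉0 u≉0 uv≈0)

  pow-≉0 : ∀ {u} → u ≉ 0# → ∀ n → pow K u n ≉ 0#
  pow-≉0 u≉0 zero    = 1≉0
  pow-≉0 u≉0 (suc n) = *-≉0 u≉0 (pow-≉0 u≉0 n)

  -1≉0 : - 1# ≉ 0#
  -1≉0 -1≈0 = 1≉0 (begin
    1#          ≈⟨ +-identityʳ 1# ⟨
    1# + 0#     ≈⟨ +-congˡ -1≈0 ⟨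
    1# + - 1#   ≈⟨ -‿inverseʳ 1# ⟩
    0#          ∎)

  vanishing-at-distinct-roots⇒zero : ∀ {n} (cs rs : Vec Carrier n) → AllPairs _≉_ rs →
                                     All (λ r → eval 0# cs r ≈ 0#) rs → All (_≈ 0#) cs
  vanishing-at-distinct-roots⇒zero []       []       _                   _                  = []
  vanishing-at-distinct-roots⇒zero (c ∷ cs) (r ∷ rs) (r≉rs ∷ distinct) (P[r]≈0 ∷ P[rs]≈0) =
    zero-quotient⇒zero c cs P[r]≈0
      (vanishing-at-distinct-roots⇒zero (quotient 0# r cs) rs distinct (All.map root⇒quotient-root (All.zip (r≉rs , P[rs]≈0))))
    where
    root⇒quotient-root : ∀ {s} → r ≉ s × eval 0# (c ∷ cs) s ≈ 0# → eval 0# (quotient 0# r cs) s ≈ 0#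
    root⇒quotient-root {s} (r≉s , P[s]≈0) =
      *-cancelˡ-≉0 (-‿≉0 r≉s) (≈0-cancelʳ (trans (sym (eval-quotient 0# r c cs s)) P[s]≈0) P[r]≈0)

module Kernels {c ℓ p} (K : CommutativeRing c ℓ) (closure : IsAlgClosureOfFp K p) (e : ℕ) where
  open CommutativeRing K
  open IsAlgClosureOfFp closure using (prime; 1≉0; inverse; char-p; alg-closed)
  open RingLemmas K
  open Polynomials K
  open import Relation.Binary.Reasoning.Setoid setoid
  open import Algebra.Solver.Ring.NaturalCoefficients.Default commutativeSemiring
  open import Algebra.Properties.CommutativeSemigroup *-commutativeSemigroup using (x∙yz≈y∙xz)

  private variable
    t : ℕ

  q : ℕ
  q = p ^ suc e

  1<q : 1 < q
  1<q = ℕ.^-monoʳ-< p (ℕ.nonTrivial⇒n>1 p {{prime⇒nonTrivial prime}}) {0} {suc e} z<s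

  q≈0 : natK K q ≈ 0#
  q≈0 = trans (natK-* p (p ^ e)) (trans (*-congʳ char-p) (zeroˡ _))

  isField : IsField K
  isField = record { 1≉0 = 1≉0 ; inverse = inverse }

  open Linearised K q
  open Field isField

  monic-root : ∀ {n} c (cs : Vec Carrier n) → ∃ λ x → eval 1# (c ∷ cs) x ≈ 0#
  monic-root c cs with alg-closed (c ∷ cs)
  ... | x , x-root = x , trans (sym (evalMonic≈eval x (c ∷ cs))) x-root

  linearised-distinct-roots : ∀ α (B : Vec Carrier t) β → α ≉ 0# → β ≉ 0# →
    ∃ λ (rs : Vec Carrier (q ^ suc t)) → AllPairs _≉_ rs × All (λ r → linearised α B β r ≈ 0#) rs
  linearised-distinct-roots {t} α B β α≉0 β≉0 =
    let rs , distinct , P[rs]≈0 = separable⇒distinct-roots monic-root P separable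
    in  rs , distinct , All.map (λ {r} P[r]≈0 → *-cancelˡ-≉0 u≉0 (trans (sym (P≈u*L r)) P[r]≈0)) P[rs]≈0
    where
    u = proj₁ (inverse β β≉0)

    1≈u*β : 1# ≈ u * β
    1≈u*β = sym (trans (*-comm u β) (proj₂ (inverse β β≉0)))

    u≉0 : u ≉ 0#
    u≉0 u≈0 = 1≉0 (trans 1≈u*β (trans (*-congʳ u≈0) (zeroˡ β)))

    P : Vec Carrier (q ^ suc t)
    P = coefficients (q ^ suc t) (linearisedCoefficients (u * α) (scale K u B))

    P≈u*L : ∀ x → eval 1# P x ≈ u * linearised α B β x
    P≈u*L x = begin
      eval 1# P x                                  ≈⟨ eval-linearisedCoefficients 1<q (u * α) (scale K u B) 1# x ⟩
      linearised (u * α) (scale K u B) 1# x        ≈⟨ linearised-cong x refl (VecEq-refl (scale K u B)) 1≈u*β ⟩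
      linearised (u * α) (scale K u B) (u * β) x   ≈⟨ linearised-scale u α B β x ⟨
      u * linearised α B β x                       ∎

    separable : Separable 1# P
    separable s _ P′[s]≈0 =
      *-≉0 u≉0 α≉0 (trans (sym (derivative-linearisedCoefficients 1<q q≈0 (u * α) (scale K u B) 1# s)) P′[s]≈0)

  linearised-vanishing : ∀ α (B : Vec Carrier t) (rs : Vec Carrier (q ^ suc t)) → AllPairs _≉_ rs →
                         All (λ r → linearised α B 0# r ≈ 0#) rs → α ≈ 0# × All (_≈ 0#) B
  linearised-vanishing {t} α B rs distinct L[rs]≈0 =
    linearisedCoefficients-vanish 1<q α B (coefficients-zero (q ^ suc t)
      (vanishing-at-distinct-roots⇒zero (coefficients (q ^ suc t) (linearisedCoefficients α B)) rs distinct
        (All.map (λ {r} L[r]≈0 → trans (eval-linearisedCoefficients 1<q α B 0# r) L[r]≈0) L[rs]≈0)))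

  sign : ℕ → Carrier
  sign t = pow K (- 1#) (suc t)

  f≈linearised : ∀ a (B : Vec Carrier t) x → f K q a B x ≈ linearised (pow K a q) B (sign t * a) x
  f≈linearised a B x = reflexive (f≡linearised a x B)

  f-distinct-roots : ∀ {a} (B : Vec Carrier t) → a ≉ 0# →
    ∃ λ (rs : Vec Carrier (q ^ suc t)) → AllPairs _≉_ rs × All (λ r → f K q a B r ≈ 0#) rs
  f-distinct-roots {t} {a} B a≉0 =
    let rs , distinct , L[rs]≈0 = linearised-distinct-roots (pow K a q) B (sign t * a) (pow-≉0 a≉0 q) (*-≉0 (pow-≉0 -1≉0 (suc t)) a≉0)
    in  rs , distinct , All.map (λ {r} L[r]≈0 → trans (f≈linearised a B r) L[r]≈0) L[rs]≈0

  f-difference : ∀ {a c′} λ′ (B D : Vec Carrier t) x → c′ ≈ λ′ * a →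
    f K q c′ D x + - λ′ * f K q a B x ≈ linearised (pow K c′ q + - λ′ * pow K a q) (zipWith _+_ D (scale K (- λ′) B)) 0# x
  f-difference {t} {a} {c′} λ′ B D x c′≈λ′a = begin
    f K q c′ D x + - λ′ * f K q a B x
      ≈⟨ +-cong (f≈linearised c′ D x) (*-congˡ (f≈linearised a B x)) ⟩
    linearised (pow K c′ q) D (s * c′) x + - λ′ * linearised (pow K a q) B (s * a) x
      ≈⟨ +-congˡ (linearised-scale (- λ′) (pow K a q) B (s * a) x) ⟩
    linearised (pow K c′ q) D (s * c′) x + linearised (- λ′ * pow K a q) (scale K (- λ′) B) (- λ′ * (s * a)) x
      ≈⟨ linearised-+ _ _ D (scale K (- λ′) B) _ _ x ⟩
    linearised α₀ B₀ (s * c′ + - λ′ * (s * a)) x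
      ≈⟨ linearised-cong x refl (VecEq-refl B₀) leading≈0 ⟩
    linearised α₀ B₀ 0# x  ∎
    where
    s  = sign t
    α₀ = pow K c′ q + - λ′ * pow K a q
    B₀ = zipWith _+_ D (scale K (- λ′) B)

    leading≈0 : s * c′ + - λ′ * (s * a) ≈ 0#
    leading≈0 = begin
      s * c′ + - λ′ * (s * a)          ≈⟨ +-congʳ (*-congˡ c′≈λ′a) ⟩
      s * (λ′ * a) + - λ′ * (s * a)
        ≈⟨ solve 4 (λ s l m a → s :* (l :* a) :+ m :* (s :* a)
                              := (l :+ m) :* (s :* a)) refl s λ′ (- λ′) a ⟩
      (λ′ + - λ′) * (s * a)            ≈⟨ *-congʳ (-‿inverseʳ λ′) ⟩
      0# * (s * a)                     ≈⟨ zeroˡ _ ⟩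
      0#                               ∎

  sameKernel⇒proportional : ∀ {a c′} {B D : Vec Carrier t} → a ≉ 0# → SameKernel K q a B c′ D →
    ∃ λ λ′ → InFq K q λ′ × c′ ≈ λ′ * a × VecEq K D (scale K λ′ B)
  sameKernel⇒proportional {t} {a} {c′} {B} {D} a≉0 same =
    λ′ , λ′∈Fq , c′≈λ′a , zipWith-x+-y*z≈0⇒VecEq λ′ D B (proj₂ coefficients≈0)
    where
    λ′ = c′ * proj₁ (inverse a a≉0)

    c′≈λ′a : c′ ≈ λ′ * a
    c′≈λ′a = sym (trans (*-assoc c′ _ a) (trans (*-congˡ (trans (*-comm _ a) (proj₂ (inverse a a≉0)))) (*-identityʳ c′)))

    G-λ′F≈0 : ∀ {r} → f K q a B r ≈ 0# → f K q c′ D r + - λ′ * f K q a B r ≈ 0#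
    G-λ′F≈0 {r} F[r]≈0 = begin
      f K q c′ D r + - λ′ * f K q a B r    ≈⟨ +-cong (proj₁ (same r) F[r]≈0) (*-congˡ F[r]≈0) ⟩
      0# + - λ′ * 0#                       ≈⟨ +-identityˡ _ ⟩
      - λ′ * 0#                            ≈⟨ zeroʳ _ ⟩
      0#                                   ∎

    coefficients≈0 = let rs , distinct , F[rs]≈0 = f-distinct-roots B a≉0 in
      linearised-vanishing _ _ rs distinct
        (All.map (λ {r} F[r]≈0 → trans (sym (f-difference λ′ B D r c′≈λ′a)) (G-λ′F≈0 F[r]≈0)) F[rs]≈0)

    λ′∈Fq : InFq K q λ′
    λ′∈Fq = *-cancelʳ-≉0 (pow-≉0 a≉0 q) (begin
      pow K λ′ q * pow K a q    ≈⟨ pow-distrib-* λ′ a q ⟨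
      pow K (λ′ * a) q          ≈⟨ pow-cong q c′≈λ′a ⟨
      pow K c′ q                ≈⟨ x+-y*z≈0⇒x≈y*z (proj₁ coefficients≈0) ⟩
      λ′ * pow K a q            ∎)

  proportional⇒sameKernel : ∀ {a c′ λ′} {B D : Vec Carrier t} → c′ ≉ 0# →
    InFq K q λ′ → c′ ≈ λ′ * a → VecEq K D (scale K λ′ B) → SameKernel K q a B c′ D
  proportional⇒sameKernel {t} {a} {c′} {λ′} {B} {D} c′≉0 λ′∈Fq c′≈λ′a D≈λ′B x =
    (λ F[x]≈0 → trans G≈λ′F (trans (*-congˡ F[x]≈0) (zeroʳ λ′))) ,
    (λ G[x]≈0 → *-cancelˡ-≉0 λ′≉0 (trans (sym G≈λ′F) G[x]≈0))
    where
    s = sign t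

    λ′≉0 : λ′ ≉ 0#
    λ′≉0 λ′≈0 = c′≉0 (trans c′≈λ′a (trans (*-congʳ λ′≈0) (zeroˡ a)))

    c′^q≈λ′a^q : pow K c′ q ≈ λ′ * pow K a q
    c′^q≈λ′a^q = begin
      pow K c′ q                ≈⟨ pow-cong q c′≈λ′a ⟩
      pow K (λ′ * a) q          ≈⟨ pow-distrib-* λ′ a q ⟩
      pow K λ′ q * pow K a q    ≈⟨ *-congʳ λ′∈Fq ⟩
      λ′ * pow K a q            ∎

    G≈λ′F : f K q c′ D x ≈ λ′ * f K q a B x
    G≈λ′F = begin
      f K q c′ D x                                                  ≈⟨ f≈linearised c′ D x ⟩
      linearised (pow K c′ q) D (s * c′) x                          ≈⟨ linearised-cong x c′^q≈λ′a^q D≈λ′B (*-congˡ c′≈λ′a) ⟩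
      linearised (λ′ * pow K a q) (scale K λ′ B) (s * (λ′ * a)) x   ≈⟨ linearised-cong x refl (VecEq-refl (scale K λ′ B)) (x∙yz≈y∙xz s λ′ a) ⟩
      linearised (λ′ * pow K a q) (scale K λ′ B) (λ′ * (s * a)) x   ≈⟨ linearised-scale λ′ (pow K a q) B (s * a) x ⟨
      λ′ * linearised (pow K a q) B (s * a) x                       ≈⟨ *-congˡ (f≈linearised a B x) ⟨
      λ′ * f K q a B x                                              ∎

lemma3p2 : ∀ {c ℓ : Level} (p e t : ℕ) → 1 ≤ e → 1 ≤ t →
    (K : CommutativeRing c ℓ) → IsAlgClosureOfFp K p →
    let open CommutativeRing K in
    (a : Carrier) → ¬ (a ≈ 0#) → (B : Vec Carrier t) →
    (c′ : Carrier) → ¬ (c′ ≈ 0#) → (D : Vec Carrier t) →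
    (SameKernel K (p ^ e) a B c′ D →
      ∃ λ λ′ → InFq K (p ^ e) λ′ × c′ ≈ λ′ * a × VecEq K D (scale K λ′ B))
    × ((∃ λ λ′ → InFq K (p ^ e) λ′ × c′ ≈ λ′ * a × VecEq K D (scale K λ′ B)) →
      SameKernel K (p ^ e) a B c′ D)
lemma3p2 p (suc e) t _ _ K closure a a≉0 B c′ c′≉0 D =
  sameKernel⇒proportional a≉0 ,
  λ (λ′ , λ′∈Fq , c′≈λ′a , D≈λ′B) → proportional⇒sameKernel c′≉0 λ′∈Fq c′≈λ′a D≈λ′B
  where
  open Kernels K closure e
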